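{- Let $n$ be an odd integer and $k$ an integer with $1\le k\le n-1$. For each positive divisor $d$ of $n$, let $\alpha_d^{k}$ (resp. $\gamma_d^{k}$) be the number of $\sigma$-orbits contained in $E_{\rm e}^{ - }(n,k)$ (resp. $E_{\rm o}^{ - }(n,k)$) whose period equals $d(n-k)$. (i) If a positive divisor $d$ of $n$ satisfies $\gcd(k,n/d)>1$, then $\alpha_d^{k}=\gamma_d^{k}=0$. (ii) If $\gcd(k,n)=1$, then $\alpha_1^{k}=\epsilon_n^{n-k}$ and $\gamma_1^{k}=1-\epsilon_n^{n-k}$.
   Context: Permutations of $[n]=\{1,\dots,n\}$ are written as words $a_1a_2\cdots a_n$. An ascent is an index $i$ ($1\le i\le n-1$) with $a_i<a_{i+1}$. An inversion is a pair $(i,j)$ with $1\le i<j\le n$ and $a_i>a_j$. $E(n,k)$ is the set of permutations of $[n]$ with exactly $k$ ascents; $E_{\rm e}(n,k)$, $E_{\rm o}(n,k)$ are its subsets of permutations with an even, respectively odd, number of inversions; $E_{\rm e}^{ - }(n,k)$, $E_{\rm o}^{ - }(n,k)$ are the permutations $a_1\cdots a_n$ in these sets with $a_1<a_n$. The operator $\sigma$ on permutations $A=a_1\cdots a_n$ of $[n]$: if $a_i=n$ for some $2\le i\le n-1$, then $\sigma(A)=b_1\cdots b_n$ with $b_j=a_j+1$ for $j\ne i$ and $b_i=1$; if $a_n=n$, then $\sigma(A)=1(a_1+1)\cdots(a_{n-1}+1)$; if $a_1=n$, then $\sigma(A)=(a_2+1)\cdots(a_n+1)1$. $\sigma$ is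 a bijection on permutations of $[n]$; the period of $A$ is the least $\ell\ge1$ with $\sigma^{\ell}A=A$, and the orbit of $A$ is $\{\sigma^jA: j\ge1\}$. For odd $n$, $\sigma$ maps $E_{\rm e}^{ - }(n,k)$ and $E_{\rm o}^{ - }(n,k)$ into themselves, so these are unions of orbits. For a positive integer $\ell$ with $\gcd(\ell,n)=1$, $P_n^{\ell}$ is the permutation $c_0c_1\cdots c_{n-1}$ of $[n]$ where $c_j\in[n]$ is the unique element with $c_j\equiv 1+j\ell \pmod n$; $\epsilon_n^{\ell}=1$ if $P_n^{\ell}$ has an even number of inversions and $\epsilon_n^{\ell}=0$ otherwise. -}

module Defs where

open import Data.Nat using (ℕ; zero; suc; _+_; _*_; _∸_; _≤_; _<_; _≡ᵇ_; _<ᵇ_)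
open import Data.Nat.DivMod using (_%_)
open import Data.Bool using (Bool; true; false; if_then_else_)
open import Data.List using (List; []; _∷_; _++_; [_]; map; length; upTo)
open import Data.List.Relation.Binary.Permutation.Propositional using (_↭_)
open import Data.List.Relation.Unary.All using (All)
open import Data.List.Relation.Unary.Any using (Any)
open import Data.List.Relation.Unary.AllPairs using (AllPairs)
open import Data.Product using (Σ; ∃-syntax; _×_)
open import Relation.Binary.PropositionalEquality using (_≡_; _≢_)
open import Relation.Nullary using (¬_)

oneToN : ℕ → List ℕ
oneToN n = map suc (upTo n)

IsPerm : ℕ → List ℕ → Set
IsPerm n A = A ↭ oneToN n

asc : List ℕ → ℕ
asc [] = 0
asc (x ∷ []) = 0
asc (x ∷ y ∷ ys) = (if x <ᵇ y then 1 else 0) + asc (y ∷ ys)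

countLess : ℕ → List ℕ → ℕ
countLess x [] = 0
countLess x (y ∷ ys) = (if y <ᵇ x then 1 else 0) + countLess x ys

inv : List ℕ → ℕ
inv [] = 0
inv (x ∷ xs) = countLess x xs + inv xs

FirstLessLast : List ℕ → Set
FirstLessLast A = ∃[ x ] ∃[ mid ] ∃[ y ] (A ≡ x ∷ (mid ++ [ y ]) × x < y)

Eminus-e : ℕ → ℕ → List ℕ → Set
Eminus-e n k A = IsPerm n A × asc A ≡ k × inv A % 2 ≡ 0 × FirstLessLast A

Eminus-o : ℕ → ℕ → List ℕ → Set
Eminus-o n k A = IsPerm n A × asc A ≡ k × inv A % 2 ≡ 1 × FirstLessLast A

bump : ℕ → ℕ → ℕ
bump n x = if x ≡ᵇ n then 1 else suc x

dropLast : List ℕ → List ℕ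
dropLast [] = []
dropLast (x ∷ []) = []
dropLast (x ∷ y ∷ ys) = x ∷ dropLast (y ∷ ys)

lastIs : ℕ → List ℕ → Bool
lastIs n [] = false
lastIs n (x ∷ []) = x ≡ᵇ n
lastIs n (x ∷ y ∷ ys) = lastIs n (y ∷ ys)

σ : ℕ → List ℕ → List ℕ
σ n [] = []
σ n (x ∷ xs) =
  if x ≡ᵇ n then map suc xs ++ [ 1 ]
  else (if lastIs n (x ∷ xs) then 1 ∷ map suc (dropLast (x ∷ xs))
        else map (bump n) (x ∷ xs))

σ^ : ℕ → ℕ → List ℕ → List ℕ
σ^ n zero A = A
σ^ n (suc j) A = σ n (σ^ n j A)

HasPeriod : ℕ → List ℕ → ℕ → Set
HasPeriod n A p = 1 ≤ p × σ^ n p A ≡ A × (∀ ℓ → 1 ≤ ℓ → ℓ < p → σ^ n ℓ A ≢ A)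

InOrbit : ℕ → List ℕ → List ℕ → Set
InOrbit n A B = ∃[ j ] (1 ≤ j × σ^ n j A ≡ B)

-- "The number of σ-orbits contained in S (a σ-stable set of permutations
-- of [n]) whose period equals p is m": there are m representatives in S
-- of period p, lying in pairwise distinct orbits, such that every
-- element of S of period p lies in the orbit of one of them.
NumOrbits : ℕ → (List ℕ → Set) → ℕ → ℕ → Set
NumOrbits n S p m =
  Σ (List (List ℕ)) λ reps →
    length reps ≡ m
    × All (λ A → S A × HasPeriod n A p) reps
    × AllPairs (λ A B → ¬ InOrbit n A B) reps
    × (∀ A → S A → HasPeriod n A p → Any (λ R → InOrbit n R A) reps)

P : ℕ → ℕ → List ℕ
P zero ℓ = []
P n@(suc _) ℓ = map (λ j → (j * ℓ) % n + 1) (upTo n)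

ε : ℕ → ℕ → ℕ
ε zero ℓ = 1
ε n@(suc _) ℓ = if (inv (P n ℓ) % 2) ≡ᵇ 0 then 1 else 0

-- A permutation a₁⋯aₙ with a₁ < aₙ is read as a cyclic sequence V j = a_(j mod n) − 1 of
-- residues mod n.  On such words σ adds 1 to every entry mod n and, whenever aₙ = n, also
-- rotates the word one place to the right, so σᵗ A is V shifted by t and rotated some r times.
-- Between consecutive rotations exactly δ l = V (−l) − V (−l−1) mod n steps elapse, and over a
-- full turn these gaps add up to n times the number of cyclic descents, that is to n (n − k).
-- If σᵖ A = A after r rotations then V (j − r) + p ≡ V j, which makes δ r-periodic and gives
-- p = δ 0 + ⋯ + δ (r − 1) = r (n − k).  For p = d (n − k) this says V (j + d) ≡ V j + p.
-- (i) If dq = n and g = gcd (k, q) > 1, then g divides n − k, so n divides (q/g) p and V takes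
-- the same value at 0 and at dq/g ∈ (0, n), contradicting injectivity.  (ii) If gcd (k, n) = 1
-- and p = n − k, then A = σ^(V 0) (P_n^(n−k)), and P_n^(n−k) has period exactly n − k.  For odd
-- n, σ preserves the parity of the number of inversions, so that single orbit is even or odd
-- according to ε_n^(n−k).
module Submission where

open import Data.Bool using (Bool; true; false; if_then_else_)
open import Data.Empty using (⊥; ⊥-elim)
open import Data.List using (List; []; _∷_; _++_; [_]; _∷ʳ_; map; length; upTo; applyUpTo)
open import Data.List.Membership.Propositional using (_∈_)
open import Data.List.Membership.Propositional.Properties using (∈-∃++; ∈-map⁺; ∈-upTo⁺)
open import Data.List.Properties
  using ( ∷-injectiveˡ; ∷-injectiveʳ; map-++; map-upTo; map-applyUpTo; length-map; length-++
        ; length-upTo; length-applyUpTo; upTo-∷ʳ; applyUpTo-∷ʳ)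
open import Data.List.Relation.Binary.Permutation.Propositional
  using (_↭_; ↭-refl; ↭-sym; ↭-prep; ↭⇒↭ₛ; module PermutationReasoning)
open import Data.List.Relation.Binary.Permutation.Propositional.Properties
  using (shift; ∷↭∷ʳ; All-resp-↭; ∈-resp-↭; ↭-length)
import Data.List.Relation.Binary.Permutation.Setoid.Properties as Permₛ
open import Data.List.Relation.Unary.All as All using (All; []; _∷_)
open import Data.List.Relation.Unary.All.Properties using (¬Any⇒All¬; map⁺; applyUpTo⁺₁; ++⁻ˡ; ++⁻ʳ)
import Data.List.Relation.Unary.AllPairs as AllPairs
open import Data.List.Relation.Unary.AllPairs using ([]; _∷_)
open import Data.List.Relation.Unary.Any using (here)
open import Data.List.Relation.Unary.Unique.Propositional using (Unique)
import Data.List.Relation.Unary.Unique.Propositional.Properties as Unique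
open import Data.Nat
open import Data.Nat.Coprimality using (Coprime; coprime-Bézout; gcd≡1⇒coprime)
open import Data.Nat.Divisibility using (_∣_; divides; ∣m+n∣m⇒∣n)
open import Data.Nat.DivMod
open import Data.Nat.GCD using (gcd; gcd[m,n]∣m; gcd[m,n]∣n; module Bézout)
open import Data.Nat.Properties
open import Data.Nat.Solver using (module +-*-Solver)
open import Data.List.Membership.DecPropositional _≟_ using (_∈?_)
open import Data.Product using (_×_; _,_; proj₁; proj₂; ∃-syntax)
open import Function using (_∘_)
open import Level using (0ℓ)
open import Relation.Binary.Bundles using (Setoid)
open import Relation.Binary.Definitions using (tri<; tri≈; tri>)
open import Relation.Binary.PropositionalEquality hiding ([_])
import Relation.Binary.Reasoning.Setoid as SetoidReasoning
open import Relation.Binary.Structures using (IsEquivalence)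
open import Relation.Nullary using (¬_; yes; no; contradiction)

open import Defs

if-true : ∀ {A : Set} {b : Bool} {x y : A} → b ≡ true → (if b then x else y) ≡ x
if-true refl = refl

if-false : ∀ {A : Set} {b : Bool} {x y : A} → b ≡ false → (if b then x else y) ≡ y
if-false refl = refl

≡ᵇ-refl : ∀ m → (m ≡ᵇ m) ≡ true
≡ᵇ-refl zero    = refl
≡ᵇ-refl (suc m) = ≡ᵇ-refl m

≢⇒≡ᵇ≡false : ∀ {m n} → m ≢ n → (m ≡ᵇ n) ≡ false
≢⇒≡ᵇ≡false {zero}  {zero}  m≢n = ⊥-elim (m≢n refl)
≢⇒≡ᵇ≡false {zero}  {suc n} _   = refl
≢⇒≡ᵇ≡false {suc m} {zero}  _   = refl
≢⇒≡ᵇ≡false {suc m} {suc n} m≢n = ≢⇒≡ᵇ≡false (m≢n ∘ cong suc)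

<⇒<ᵇ≡true : ∀ {m n} → m < n → (m <ᵇ n) ≡ true
<⇒<ᵇ≡true {zero}  z<s       = refl
<⇒<ᵇ≡true {suc m} (s≤s m<n) = <⇒<ᵇ≡true m<n

≥⇒<ᵇ≡false : ∀ {m n} → n ≤ m → (m <ᵇ n) ≡ false
≥⇒<ᵇ≡false z≤n       = refl
≥⇒<ᵇ≡false (s≤s n≤m) = ≥⇒<ᵇ≡false n≤m

applyUpTo-cong : ∀ {A : Set} m {f g : ℕ → A} →
  (∀ {j} → j < m → f j ≡ g j) → applyUpTo f m ≡ applyUpTo g m
applyUpTo-cong zero    f≗g = refl
applyUpTo-cong (suc m) f≗g = cong₂ _∷_ (f≗g z<s) (applyUpTo-cong m (f≗g ∘ s<s))

applyUpTo-cong⁻¹ : ∀ {A : Set} m {f g : ℕ → A} →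
  applyUpTo f m ≡ applyUpTo g m → ∀ {j} → j < m → f j ≡ g j
applyUpTo-cong⁻¹ (suc m) eq {zero}  _         = ∷-injectiveˡ eq
applyUpTo-cong⁻¹ (suc m) eq {suc j} (s<s j<m) = applyUpTo-cong⁻¹ m (∷-injectiveʳ eq) j<m

at : List ℕ → ℕ → ℕ
at []       _       = 0
at (x ∷ xs) zero    = x
at (x ∷ xs) (suc j) = at xs j

applyUpTo-at : ∀ xs → applyUpTo (at xs) (length xs) ≡ xs
applyUpTo-at []       = refl
applyUpTo-at (x ∷ xs) = cong (x ∷_) (applyUpTo-at xs)

at-∷ʳ : ∀ xs y → at (xs ∷ʳ y) (length xs) ≡ y
at-∷ʳ []       y = refl
at-∷ʳ (x ∷ xs) y = at-∷ʳ xs y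

All-at : ∀ {P : ℕ → Set} {xs} → All P xs → ∀ {i} → i < length xs → P (at xs i)
All-at (px ∷ _)   {zero}  _         = px
All-at (_  ∷ pxs) {suc i} (s<s i<n) = All-at pxs i<n

Unique-at-injective : ∀ {xs} → Unique xs → ∀ {i j} → i < length xs → j < length xs →
  at xs i ≡ at xs j → i ≡ j
Unique-at-injective (_ ∷ _)      {zero}  {zero}  _         _         _  = refl
Unique-at-injective (x≢ ∷ _)     {zero}  {suc j} _         (s<s j<n) eq = ⊥-elim (All-at x≢ j<n eq)
Unique-at-injective (x≢ ∷ _)     {suc i} {zero}  (s<s i<n) _         eq = ⊥-elim (All-at x≢ i<n (sym eq))
Unique-at-injective (_ ∷ unique) {suc i} {suc j} (s<s i<n) (s<s j<n) eq =
  cong suc (Unique-at-injective unique i<n j<n eq)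

sumUpTo : (ℕ → ℕ) → ℕ → ℕ
sumUpTo f zero    = 0
sumUpTo f (suc m) = sumUpTo f m + f m

sumUpTo-cong : ∀ m {f g : ℕ → ℕ} → (∀ {l} → l < m → f l ≡ g l) → sumUpTo f m ≡ sumUpTo g m
sumUpTo-cong zero    f≗g = refl
sumUpTo-cong (suc m) f≗g = cong₂ _+_ (sumUpTo-cong m (f≗g ∘ m<n⇒m<1+n)) (f≗g ≤-refl)

sumUpTo-suc : ∀ m f → sumUpTo f (suc m) ≡ f 0 + sumUpTo (f ∘ suc) m
sumUpTo-suc zero    f = +-comm 0 (f 0)
sumUpTo-suc (suc m) f = begin
  sumUpTo f (suc m) + f (suc m)          ≡⟨ cong (_+ f (suc m)) (sumUpTo-suc m f) ⟩
  f 0 + sumUpTo (f ∘ suc) m + f (suc m)  ≡⟨ +-assoc (f 0) _ _ ⟩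
  f 0 + sumUpTo (f ∘ suc) (suc m)        ∎
  where open ≡-Reasoning

sumUpTo-+ : ∀ a b f → sumUpTo f (a + b) ≡ sumUpTo f a + sumUpTo (λ l → f (a + l)) b
sumUpTo-+ a zero    f = trans (cong (sumUpTo f) (+-identityʳ a)) (sym (+-identityʳ _))
sumUpTo-+ a (suc b) f = begin
  sumUpTo f (a + suc b)                                    ≡⟨ cong (sumUpTo f) (+-suc a b) ⟩
  sumUpTo f (a + b) + f (a + b)                            ≡⟨ cong (_+ f (a + b)) (sumUpTo-+ a b f) ⟩
  sumUpTo f a + sumUpTo (λ l → f (a + l)) b + f (a + b)    ≡⟨ +-assoc (sumUpTo f a) _ _ ⟩
  sumUpTo f a + sumUpTo (λ l → f (a + l)) (suc b)          ∎
  where open ≡-Reasoning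

sumUpTo-periodic : ∀ q f → (∀ l → f (q + l) ≡ f l) → ∀ b → sumUpTo f (b * q) ≡ b * sumUpTo f q
sumUpTo-periodic q f periodic zero    = refl
sumUpTo-periodic q f periodic (suc b) = begin
  sumUpTo f (q + b * q)                                 ≡⟨ sumUpTo-+ q (b * q) f ⟩
  sumUpTo f q + sumUpTo (λ l → f (q + l)) (b * q)       ≡⟨ cong (sumUpTo f q +_) (sumUpTo-cong (b * q) (λ {l} _ → periodic l)) ⟩
  sumUpTo f q + sumUpTo f (b * q)                       ≡⟨ cong (sumUpTo f q +_) (sumUpTo-periodic q f periodic b) ⟩
  sumUpTo f q + b * sumUpTo f q                         ∎
  where open ≡-Reasoning

sumUpTo-const : ∀ m c → sumUpTo (λ _ → c) m ≡ m * c
sumUpTo-const zero    c = refl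
sumUpTo-const (suc m) c = trans (cong (_+ c) (sumUpTo-const m c)) (+-comm (m * c) c)

sumUpTo-reverse : ∀ m f → sumUpTo (λ l → f (m ∸ l)) (suc m) ≡ sumUpTo f (suc m)
sumUpTo-reverse zero    f = refl
sumUpTo-reverse (suc m) f = begin
  sumUpTo (λ l → f (suc m ∸ l)) (suc (suc m))   ≡⟨ sumUpTo-suc (suc m) (λ l → f (suc m ∸ l)) ⟩
  f (suc m) + sumUpTo (λ l → f (m ∸ l)) (suc m) ≡⟨ cong (f (suc m) +_) (sumUpTo-reverse m f) ⟩
  f (suc m) + sumUpTo f (suc m)                 ≡⟨ +-comm (f (suc m)) _ ⟩
  sumUpTo f (suc (suc m))                       ∎
  where open ≡-Reasoning

-- Permutations of [n]

Unique-resp-↭ : ∀ {xs ys : List ℕ} → xs ↭ ys → Unique xs → Unique ys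
Unique-resp-↭ = Permₛ.Unique-resp-↭ (setoid ℕ) ∘ ↭⇒↭ₛ

InRange : ℕ → ℕ → Set
InRange m x = 1 ≤ x × x ≤ m

oneToN-∷ʳ : ∀ m → oneToN (suc m) ≡ oneToN m ∷ʳ suc m
oneToN-∷ʳ m = trans (cong (map suc) (sym (upTo-∷ʳ m))) (map-++ suc (upTo m) [ m ])

length-oneToN : ∀ m → length (oneToN m) ≡ m
length-oneToN m = trans (length-map suc (upTo m)) (length-upTo m)

module _ {m L} (L↭ : IsPerm m L) where

  IsPerm⇒Unique : Unique L
  IsPerm⇒Unique = Unique-resp-↭ (↭-sym L↭) (Unique.map⁺ suc-injective (Unique.upTo⁺ m))

  IsPerm⇒InRange : All (InRange m) L
  IsPerm⇒InRange = All-resp-↭ (↭-sym L↭) (map⁺ (applyUpTo⁺₁ _ m (λ j<m → s≤s z≤n , j<m)))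

  IsPerm⇒length : length L ≡ m
  IsPerm⇒length = trans (↭-length L↭) (length-oneToN m)

IsPerm⇒∋max : ∀ {m L} → IsPerm (suc m) L → suc m ∈ L
IsPerm⇒∋max {m} L↭ = ∈-resp-↭ (↭-sym L↭) (∈-map⁺ suc (∈-upTo⁺ ≤-refl))

InRange-pred : ∀ {m x} → InRange (suc m) x × suc m ≢ x → InRange m x
InRange-pred ((1≤x , x≤1+m) , 1+m≢x) = 1≤x , ≤-pred (≤∧≢⇒< x≤1+m (1+m≢x ∘ sym))

unique⇒IsPerm : ∀ m {L} → Unique L → All (InRange m) L → m ≤ length L → IsPerm m L
unique⇒IsPerm zero    {[]}    _ _                 _ = ↭-refl
unique⇒IsPerm zero    {_ ∷ _} _ ((1≤x , x≤0) ∷ _) _ = contradiction (≤-trans 1≤x x≤0) λ ()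
unique⇒IsPerm (suc m) {L} unique inRange m<|L| with suc m ∈? L
... | no m∉L = contradiction (≤-trans m<|L| (≤-reflexive (IsPerm⇒length L↭))) (n≮n m)
  where
    L↭ : IsPerm m L
    L↭ = unique⇒IsPerm m unique (All.zipWith InRange-pred (inRange , ¬Any⇒All¬ L m∉L)) (<⇒≤ m<|L|)
... | yes m∈L with xs , ys , refl ← ∈-∃++ m∈L = begin
    xs ++ [ suc m ] ++ ys ↭⟨ moved ⟩
    suc m ∷ xs ++ ys      ↭⟨ ↭-prep (suc m) (unique⇒IsPerm m rest-unique rest-inRange rest-long) ⟩
    suc m ∷ oneToN m      ↭⟨ ∷↭∷ʳ (suc m) (oneToN m) ⟩
    oneToN m ∷ʳ suc m     ≡⟨ oneToN-∷ʳ m ⟨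
    oneToN (suc m)        ∎
  where
    open PermutationReasoning
    moved : xs ++ [ suc m ] ++ ys ↭ suc m ∷ xs ++ ys
    moved = shift (suc m) xs ys
    moved-unique : Unique (suc m ∷ xs ++ ys)
    moved-unique = Unique-resp-↭ moved unique
    rest-unique : Unique (xs ++ ys)
    rest-unique = AllPairs.tail moved-unique
    rest-inRange : All (InRange m) (xs ++ ys)
    rest-inRange = All.zipWith InRange-pred (All.tail (All-resp-↭ moved inRange) , AllPairs.head moved-unique)
    rest-long : m ≤ length (xs ++ ys)
    rest-long = ≤-pred (≤-trans m<|L| (≤-reflexive (↭-length moved)))

-- σ and inversions

lastIs-∷ʳ : ∀ v xs y → lastIs v (xs ∷ʳ y) ≡ (y ≡ᵇ v)
lastIs-∷ʳ v []           y = refl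
lastIs-∷ʳ v (x ∷ [])     y = refl
lastIs-∷ʳ v (x ∷ x′ ∷ xs) y = lastIs-∷ʳ v (x′ ∷ xs) y

lastIs-++-∷ : ∀ v xs y ys → lastIs v (xs ++ y ∷ ys) ≡ lastIs v (y ∷ ys)
lastIs-++-∷ v []            y ys = refl
lastIs-++-∷ v (x ∷ [])      y ys = refl
lastIs-++-∷ v (x ∷ x′ ∷ xs) y ys = lastIs-++-∷ v (x′ ∷ xs) y ys

lastIs-absent : ∀ v {xs} → All (_< v) xs → lastIs v xs ≡ false
lastIs-absent v []               = refl
lastIs-absent v (x<v ∷ [])       = ≢⇒≡ᵇ≡false (<⇒≢ x<v)
lastIs-absent v (_ ∷ x′<v ∷ xs<v) = lastIs-absent v (x′<v ∷ xs<v)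

dropLast-∷ʳ : ∀ xs (y : ℕ) → dropLast (xs ∷ʳ y) ≡ xs
dropLast-∷ʳ []            y = refl
dropLast-∷ʳ (x ∷ [])      y = refl
dropLast-∷ʳ (x ∷ x′ ∷ xs) y = cong (x ∷_) (dropLast-∷ʳ (x′ ∷ xs) y)

map-bump : ∀ v {xs} → All (_< v) xs → map (bump v) xs ≡ map suc xs
map-bump v []           = refl
map-bump v (x<v ∷ xs<v) = cong₂ _∷_ (if-false (≢⇒≡ᵇ≡false (<⇒≢ x<v))) (map-bump v xs<v)

σ-rotate : ∀ {n} x xs → x ≢ n → σ n (x ∷ xs ∷ʳ n) ≡ 1 ∷ map suc (x ∷ xs)
σ-rotate {n} x xs x≢n = begin
  σ n (x ∷ xs ∷ʳ n)                         ≡⟨ if-false (≢⇒≡ᵇ≡false x≢n) ⟩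
  (if lastIs n (x ∷ xs ∷ʳ n) then 1 ∷ map suc (dropLast (x ∷ xs ∷ʳ n))
   else map (bump n) (x ∷ xs ∷ʳ n))         ≡⟨ if-true (trans (lastIs-∷ʳ n (x ∷ xs) n) (≡ᵇ-refl n)) ⟩
  1 ∷ map suc (dropLast (x ∷ xs ∷ʳ n))      ≡⟨ cong (λ ys → 1 ∷ map suc ys) (dropLast-∷ʳ (x ∷ xs) n) ⟩
  1 ∷ map suc (x ∷ xs)                      ∎
  where open ≡-Reasoning

σ-shift : ∀ {n} x xs → x ≢ n → lastIs n (x ∷ xs) ≡ false → σ n (x ∷ xs) ≡ map (bump n) (x ∷ xs)
σ-shift x xs x≢n last≢n = trans (if-false (≢⇒≡ᵇ≡false x≢n)) (if-false last≢n)

σ-inner-max : ∀ {n x xs y ys} → All (_< n) (x ∷ xs) → All (_< n) (y ∷ ys) →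
  σ n (x ∷ xs ++ n ∷ y ∷ ys) ≡ map suc (x ∷ xs) ++ 1 ∷ map suc (y ∷ ys)
σ-inner-max {n} {x} {xs} {y} {ys} xs<n@(x<n ∷ _) ys<n = begin
  σ n (x ∷ xs ++ n ∷ y ∷ ys)
    ≡⟨ σ-shift x (xs ++ n ∷ y ∷ ys) (<⇒≢ x<n) (trans (lastIs-++-∷ n (x ∷ xs) n (y ∷ ys)) (lastIs-absent n ys<n)) ⟩
  map (bump n) (x ∷ xs ++ n ∷ y ∷ ys)
    ≡⟨ map-++ (bump n) (x ∷ xs) (n ∷ y ∷ ys) ⟩
  map (bump n) (x ∷ xs) ++ bump n n ∷ map (bump n) (y ∷ ys)
    ≡⟨ cong₂ _++_ (map-bump n xs<n) (cong₂ _∷_ (if-true (≡ᵇ-refl n)) (map-bump n ys<n)) ⟩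
  map suc (x ∷ xs) ++ 1 ∷ map suc (y ∷ ys) ∎
  where open ≡-Reasoning

σ^-+ : ∀ n a b A → σ^ n (a + b) A ≡ σ^ n a (σ^ n b A)
σ^-+ n zero    b A = refl
σ^-+ n (suc a) b A = cong (σ n) (σ^-+ n a b A)

countLess-++ : ∀ x as bs → countLess x (as ++ bs) ≡ countLess x as + countLess x bs
countLess-++ x []       bs = refl
countLess-++ x (a ∷ as) bs =
  trans (cong ((if a <ᵇ x then 1 else 0) +_) (countLess-++ x as bs))
        (sym (+-assoc (if a <ᵇ x then 1 else 0) _ _))

countLess-map-suc : ∀ x as → countLess (suc x) (map suc as) ≡ countLess x as
countLess-map-suc x []       = refl
countLess-map-suc x (a ∷ as) = cong ((if a <ᵇ x then 1 else 0) +_) (countLess-map-suc x as)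

countLess-1-map-suc : ∀ as → countLess 1 (map suc as) ≡ 0
countLess-1-map-suc []       = refl
countLess-1-map-suc (a ∷ as) = countLess-1-map-suc as

inv-map-suc : ∀ as → inv (map suc as) ≡ inv as
inv-map-suc []       = refl
inv-map-suc (a ∷ as) = cong₂ _+_ (countLess-map-suc a as) (inv-map-suc as)

countLess-below : ∀ v {as} → All (_< v) as → countLess v as ≡ length as
countLess-below v []           = refl
countLess-below v (a<v ∷ as<v) rewrite <⇒<ᵇ≡true a<v = cong suc (countLess-below v as<v)

inv-∷ʳ-max : ∀ v {as} → All (_≤ v) as → inv (as ∷ʳ v) ≡ inv as
inv-∷ʳ-max v {[]}     []           = refl
inv-∷ʳ-max v {a ∷ as} (a≤v ∷ as≤v) = cong₂ _+_ last-not-counted (inv-∷ʳ-max v as≤v)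
  where
    last-not-counted : countLess a (as ∷ʳ v) ≡ countLess a as
    last-not-counted rewrite countLess-++ a as [ v ] | ≥⇒<ᵇ≡false a≤v = +-identityʳ _

countLess-max↦1 : ∀ {x v} as bs → 1 ≤ x → x < v →
  countLess (suc x) (map suc as ++ 1 ∷ map suc bs) ≡ suc (countLess x (as ++ v ∷ bs))
countLess-max↦1 {suc x} {v} [] bs _ x<v
  rewrite countLess-map-suc (suc x) bs | ≥⇒<ᵇ≡false (<⇒≤ x<v) = refl
countLess-max↦1 {x} (a ∷ as) bs 1≤x x<v =
  trans (cong ((if a <ᵇ x then 1 else 0) +_) (countLess-max↦1 as bs 1≤x x<v)) (+-suc _ _)

inv-max↦1 : ∀ v {as bs} → All (λ a → 1 ≤ a × a < v) as → All (_< v) bs →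
  inv (map suc as ++ 1 ∷ map suc bs) + length bs ≡ inv (as ++ v ∷ bs) + length as
inv-max↦1 v {[]} {bs} [] bs<v = begin
  countLess 1 (map suc bs) + inv (map suc bs) + length bs ≡⟨ cong₂ (λ c i → c + i + length bs) (countLess-1-map-suc bs) (inv-map-suc bs) ⟩
  inv bs + length bs                                      ≡⟨ +-comm (inv bs) _ ⟩
  length bs + inv bs                                      ≡⟨ cong (_+ inv bs) (countLess-below v bs<v) ⟨
  countLess v bs + inv bs                                 ≡⟨ +-identityʳ _ ⟨
  countLess v bs + inv bs + 0                             ∎
  where open ≡-Reasoning
inv-max↦1 v {a ∷ as} {bs} ((1≤a , a<v) ∷ as-ok) bs<v = begin
  countLess (suc a) (map suc as ++ 1 ∷ map suc bs) + inv σas + length bs ≡⟨ cong (λ c → c + inv σas + length bs) (countLess-max↦1 as bs 1≤a a<v) ⟩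
  suc c + inv σas + length bs                                            ≡⟨ +-assoc (suc c) _ _ ⟩
  suc c + (inv σas + length bs)                                          ≡⟨ cong (suc c +_) (inv-max↦1 v as-ok bs<v) ⟩
  suc c + (inv (as ++ v ∷ bs) + length as)                               ≡⟨ solve 3 (λ c i l → con 1 :+ c :+ (i :+ l) := c :+ i :+ (con 1 :+ l)) refl c (inv (as ++ v ∷ bs)) (length as) ⟩
  c + inv (as ++ v ∷ bs) + suc (length as)                               ∎
  where
    open ≡-Reasoning
    open +-*-Solver
    σas : List ℕ
    σas = map suc as ++ 1 ∷ map suc bs
    c : ℕ
    c = countLess a (as ++ v ∷ bs)

parity-balance : ∀ a b x y h → a + y ≡ b + x → x + y ≡ h * 2 → a % 2 ≡ b % 2
parity-balance a b x y h a+y≡b+x x+y≡2h = begin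
  a % 2           ≡⟨ [m+kn]%n≡m%n a h 2 ⟨
  (a + h * 2) % 2 ≡⟨ cong (_% 2) a+2h≡b+2x ⟩
  (b + x * 2) % 2 ≡⟨ [m+kn]%n≡m%n b x 2 ⟩
  b % 2           ∎
  where
    open ≡-Reasoning
    open +-*-Solver
    a+2h≡b+2x : a + h * 2 ≡ b + x * 2
    a+2h≡b+2x = begin
      a + h * 2       ≡⟨ cong (a +_) x+y≡2h ⟨
      a + (x + y)     ≡⟨ solve 3 (λ a x y → a :+ (x :+ y) := (a :+ y) :+ x) refl a x y ⟩
      a + y + x       ≡⟨ cong (_+ x) a+y≡b+x ⟩
      b + x + x       ≡⟨ solve 2 (λ b x → b :+ x :+ x := b :+ x :* con 2) refl b x ⟩
      b + x * 2       ∎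

-- σ either moves a final n to the front as 1, or replaces an inner n by 1; the latter changes
-- inv by |after| − |before|, and |before| + |after| = n − 1 is even.
σ-preserves-inv-parity : ∀ {n L} → n % 2 ≡ 1 → IsPerm n L → (∀ {xs} → L ≢ n ∷ xs) →
  inv (σ n L) % 2 ≡ inv L % 2
σ-preserves-inv-parity {suc N} {L} odd L↭ head≢n
  with xs , ys , refl ← ∈-∃++ (IsPerm⇒∋max L↭) =
  by-position xs ys head≢n (++⁻ˡ xs others) (++⁻ʳ xs others) |xs|+|ys|≡N
  where
    n : ℕ
    n = suc N
    Other : ℕ → Set
    Other a = 1 ≤ a × a < n
    moved : xs ++ [ n ] ++ ys ↭ n ∷ xs ++ ys
    moved = shift n xs ys
    others : All Other (xs ++ ys)
    others = All.zipWith (λ ((1≤a , a≤n) , n≢a) → 1≤a , ≤∧≢⇒< a≤n (n≢a ∘ sym))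
      (All.tail (All-resp-↭ moved (IsPerm⇒InRange L↭)) , AllPairs.head (Unique-resp-↭ moved (IsPerm⇒Unique L↭)))
    |xs|+|ys|≡N : length xs + length ys ≡ N
    |xs|+|ys|≡N = suc-injective (begin
      suc (length xs + length ys) ≡⟨ +-suc (length xs) _ ⟨
      length xs + length (n ∷ ys) ≡⟨ length-++ xs ⟨
      length (xs ++ n ∷ ys)       ≡⟨ IsPerm⇒length L↭ ⟩
      n                           ∎)
      where open ≡-Reasoning
    N-even : N ≡ (n / 2) * 2
    N-even = suc-injective (trans (m≡m%n+[m/n]*n n 2) (cong (_+ (n / 2) * 2) odd))
    by-position : ∀ xs ys → (∀ {zs} → xs ++ n ∷ ys ≢ n ∷ zs) → All Other xs → All Other ys →
      length xs + length ys ≡ N → inv (σ n (xs ++ n ∷ ys)) % 2 ≡ inv (xs ++ n ∷ ys) % 2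
    by-position [] ys head≢n _ _ _ = ⊥-elim (head≢n refl)
    by-position (x ∷ xs) [] _ xs-ok@((_ , x<n) ∷ _) _ _ = cong (_% 2) (begin
      inv (σ n (x ∷ xs ∷ʳ n))                                  ≡⟨ cong inv (σ-rotate x xs (<⇒≢ x<n)) ⟩
      countLess 1 (map suc (x ∷ xs)) + inv (map suc (x ∷ xs))  ≡⟨ cong₂ _+_ (countLess-1-map-suc (x ∷ xs)) (inv-map-suc (x ∷ xs)) ⟩
      inv (x ∷ xs)                                             ≡⟨ inv-∷ʳ-max n (All.map (<⇒≤ ∘ proj₂) xs-ok) ⟨
      inv (x ∷ xs ∷ʳ n)                                        ∎)
      where open ≡-Reasoning
    by-position (x ∷ xs) (y ∷ ys) _ xs-ok ys-ok |xs|+|ys|≡N =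
      parity-balance _ _ (length (x ∷ xs)) (length (y ∷ ys)) (n / 2)
        (trans (cong (λ zs → inv zs + length (y ∷ ys)) (σ-inner-max (All.map proj₂ xs-ok) ys<n))
               (inv-max↦1 n xs-ok ys<n))
        (trans |xs|+|ys|≡N N-even)
      where
        ys<n : All (_< n) (y ∷ ys)
        ys<n = All.map proj₂ ys-ok

-- Arithmetic modulo n

module Congruence (N : ℕ) where

  n : ℕ
  n = suc N

  -- A record rather than a synonym for a % n ≡ b % n, so that a and b can be inferred.
  infix 4 _≋_
  record _≋_ (a b : ℕ) : Set where
    constructor mk≋
    field %-≡ : a % n ≡ b % n
  open _≋_ public

  ≋-isEquivalence : IsEquivalence _≋_
  ≋-isEquivalence = record
    { refl  = mk≋ refl
    ; sym   = λ (mk≋ a≋b) → mk≋ (sym a≋b)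
    ; trans = λ (mk≋ a≋b) (mk≋ b≋c) → mk≋ (trans a≋b b≋c)
    }

  ≋-setoid : Setoid 0ℓ 0ℓ
  ≋-setoid = record { isEquivalence = ≋-isEquivalence }

  open IsEquivalence ≋-isEquivalence public using ()
    renaming (refl to ≋-refl; sym to ≋-sym; trans to ≋-trans)

  module ≋-Reasoning = SetoidReasoning ≋-setoid

  ≡⇒≋ : ∀ {a b} → a ≡ b → a ≋ b
  ≡⇒≋ refl = ≋-refl

  %-≋ : ∀ a → a % n ≋ a
  %-≋ a = mk≋ (m%n%n≡m%n a n)

  ≋⇒≡ : ∀ {a b} → a < n → b < n → a ≋ b → a ≡ b
  ≋⇒≡ a<n b<n (mk≋ a≋b) = trans (sym (m<n⇒m%n≡m a<n)) (trans a≋b (m<n⇒m%n≡m b<n))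

  +-cong-≋ : ∀ {a b c d} → a ≋ b → c ≋ d → a + c ≋ b + d
  +-cong-≋ {a} {b} {c} {d} (mk≋ a≋b) (mk≋ c≋d) = mk≋ (begin
    (a + c) % n         ≡⟨ %-distribˡ-+ a c n ⟩
    (a % n + c % n) % n ≡⟨ cong₂ (λ x y → (x + y) % n) a≋b c≋d ⟩
    (b % n + d % n) % n ≡⟨ %-distribˡ-+ b d n ⟨
    (b + d) % n         ∎)
    where open ≡-Reasoning

  *-cong-≋ : ∀ {a b c d} → a ≋ b → c ≋ d → a * c ≋ b * d
  *-cong-≋ {a} {b} {c} {d} (mk≋ a≋b) (mk≋ c≋d) = mk≋ (begin
    (a * c) % n           ≡⟨ %-distribˡ-* a c n ⟩
    (a % n * (c % n)) % n ≡⟨ cong₂ (λ x y → (x * y) % n) a≋b c≋d ⟩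
    (b % n * (d % n)) % n ≡⟨ %-distribˡ-* b d n ⟨
    (b * d) % n           ∎)
    where open ≡-Reasoning

  n≋0 : n ≋ 0
  n≋0 = mk≋ (n%n≡0 n)

  *n≋0 : ∀ k → k * n ≋ 0
  *n≋0 k = mk≋ (m*n%n≡0 k n)

  n*≋0 : ∀ k → n * k ≋ 0
  n*≋0 k = ≋-trans (≡⇒≋ (*-comm n k)) (*n≋0 k)

  ∣⇒≋0 : ∀ {a} → n ∣ a → a ≋ 0
  ∣⇒≋0 (divides m a≡mn) = ≋-trans (≡⇒≋ a≡mn) (*n≋0 m)

  +-≋0 : ∀ a {z} → z ≋ 0 → a + z ≋ a
  +-≋0 a z≋0 = ≋-trans (+-cong-≋ ≋-refl z≋0) (≡⇒≋ (+-identityʳ a))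

  +-cancelʳ-≋ : ∀ {a b} c → a + c ≋ b + c → a ≋ b
  +-cancelʳ-≋ {a} {b} c a+c≋b+c = begin
    a             ≈⟨ +-≋0 a (n*≋0 c) ⟨
    a + n * c     ≡⟨ +-assoc a c (N * c) ⟨
    a + c + N * c ≈⟨ +-cong-≋ a+c≋b+c ≋-refl ⟩
    b + c + N * c ≡⟨ +-assoc b c (N * c) ⟩
    b + n * c     ≈⟨ +-≋0 b (n*≋0 c) ⟩
    b             ∎
    where open ≋-Reasoning

  suc-% : ∀ a → a % n ≢ N → suc a % n ≡ suc (a % n)
  suc-% a a%n≢N = trans (%-≡ (+-cong-≋ (≋-refl {1}) (≋-sym (%-≋ a))))
                        (m<n⇒m%n≡m (s≤s (≤∧≢⇒< (≤-pred (m%n<n a n)) a%n≢N)))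

  suc-%-wrap : ∀ a → a % n ≡ N → suc a % n ≡ 0
  suc-%-wrap a a%n≡N = trans (%-≡ (+-cong-≋ (≋-refl {1}) (≋-sym (%-≋ a))))
                             (trans (cong (λ r → suc r % n) a%n≡N) (n%n≡0 n))

  coprime⇒invertible : ∀ {c} → Coprime c n → ∃[ w ] c * w ≋ 1
  coprime⇒invertible {c} coprime with coprime-Bézout coprime
  ... | Bézout.+- x y 1+yn≡xc = x , (begin
    c * x     ≡⟨ *-comm c x ⟩
    x * c     ≡⟨ 1+yn≡xc ⟨
    1 + y * n ≈⟨ +-≋0 1 (*n≋0 y) ⟩
    1         ∎)
    where open ≋-Reasoning
  ... | Bézout.-+ x y 1+xc≡yn = x * N , +-cancelʳ-≋ N (begin
    c * (x * N) + N ≡⟨ solve 3 (λ c x N → c :* (x :* N) :+ N := (con 1 :+ x :* c) :* N) refl c x N ⟩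
    (1 + x * c) * N ≡⟨ cong (_* N) 1+xc≡yn ⟩
    y * n * N       ≡⟨ solve 3 (λ y n N → y :* n :* N := y :* N :* n) refl y n N ⟩
    y * N * n       ≈⟨ *n≋0 (y * N) ⟩
    0               ≈⟨ n≋0 ⟨
    1 + N           ∎)
    where
      open ≋-Reasoning
      open +-*-Solver

  *-cancelʳ-≋ : ∀ {c} → Coprime c n → ∀ {a b} → a * c ≋ b * c → a ≋ b
  *-cancelʳ-≋ {c} coprime {a} {b} ac≋bc with w , cw≋1 ← coprime⇒invertible coprime = begin
    a           ≡⟨ *-identityʳ a ⟨
    a * 1       ≈⟨ *-cong-≋ (≋-refl {a}) cw≋1 ⟨
    a * (c * w) ≡⟨ *-assoc a c w ⟨
    a * c * w   ≈⟨ *-cong-≋ ac≋bc ≋-refl ⟩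
    b * c * w   ≡⟨ *-assoc b c w ⟩
    b * (c * w) ≈⟨ *-cong-≋ (≋-refl {b}) cw≋1 ⟩
    b * 1       ≡⟨ *-identityʳ b ⟩
    b           ∎
    where open ≋-Reasoning

  -- N ≡ −1 (mod n), so gap a b is the residue of b − a.
  gap : ℕ → ℕ → ℕ
  gap a b = (b + N * a) % n

  gap<n : ∀ a b → gap a b < n
  gap<n a b = m%n<n (b + N * a) n

  gap-+ : ∀ a b → gap a b + a ≋ b
  gap-+ a b = begin
    gap a b + a       ≈⟨ +-cong-≋ (%-≋ (b + N * a)) ≋-refl ⟩
    b + N * a + a     ≡⟨ +-assoc b (N * a) a ⟩
    b + (N * a + a)   ≡⟨ cong (b +_) (+-comm (N * a) a) ⟩
    b + n * a         ≈⟨ +-≋0 b (n*≋0 a) ⟩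
    b                 ∎
    where open ≋-Reasoning

  gap-unique : ∀ {a b w} → w < n → w + a ≋ b → gap a b ≡ w
  gap-unique {a} {b} w<n w+a≋b =
    ≋⇒≡ (gap<n a b) w<n (+-cancelʳ-≋ a (≋-trans (gap-+ a b) (≋-sym w+a≋b)))

  gap-exact : ∀ {a b} → a ≤ b → b < n → gap a b + a ≡ b
  gap-exact {a} {b} a≤b b<n = trans (cong (_+ a) (gap-unique w<n (≡⇒≋ w+a≡b))) w+a≡b
    where
      w+a≡b : b ∸ a + a ≡ b
      w+a≡b = m∸n+n≡m a≤b
      w<n : b ∸ a < n
      w<n = ≤-<-trans (m∸n≤m b a) b<n

  gap-wraps : ∀ {a b} → b < a → a < n → gap a b + a ≡ b + n
  gap-wraps {a} {b} b<a a<n = trans (cong (_+ a) (gap-unique w<n w+a≋b)) w+a≡b+n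
    where
      w+a≡b+n : b + n ∸ a + a ≡ b + n
      w+a≡b+n = m∸n+n≡m (≤-trans (<⇒≤ a<n) (m≤n+m n b))
      w+a≋b : b + n ∸ a + a ≋ b
      w+a≋b = ≋-trans (≡⇒≋ w+a≡b+n) (+-≋0 b n≋0)
      w<n : b + n ∸ a < n
      w<n = +-cancelʳ-< a (b + n ∸ a) n
        (subst₂ _<_ (sym w+a≡b+n) (+-comm a n) (+-monoˡ-< n b<a))

  gap-step : ∀ {a b} → a < n → b < n → a ≢ b →
    gap a b + a + n * (if a <ᵇ b then 1 else 0) ≡ b + n
  gap-step {a} {b} a<n b<n a≢b with <-cmp a b
  ... | tri< a<b _ _ = begin
    gap a b + a + n * (if a <ᵇ b then 1 else 0) ≡⟨ cong (λ β → gap a b + a + n * (if β then 1 else 0)) (<⇒<ᵇ≡true a<b) ⟩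
    gap a b + a + n * 1                         ≡⟨ cong₂ _+_ (gap-exact (<⇒≤ a<b) b<n) (*-identityʳ n) ⟩
    b + n                                       ∎
    where open ≡-Reasoning
  ... | tri≈ _ a≡b _ = ⊥-elim (a≢b a≡b)
  ... | tri> _ _ b<a = begin
    gap a b + a + n * (if a <ᵇ b then 1 else 0) ≡⟨ cong (λ β → gap a b + a + n * (if β then 1 else 0)) (≥⇒<ᵇ≡false (<⇒≤ b<a)) ⟩
    gap a b + a + n * 0                         ≡⟨ cong₂ _+_ (gap-wraps b<a a<n) (*-zeroʳ n) ⟩
    b + n + 0                                   ≡⟨ +-identityʳ _ ⟩
    b + n                                       ∎
    where open ≡-Reasoning

  gaps-telescope : ∀ m (g : ℕ → ℕ) → (∀ i → g i < n) → (∀ {i} → i < m → g i ≢ g (suc i)) →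
    sumUpTo (λ i → gap (g i) (g (suc i))) m + g 0 + n * asc (applyUpTo (suc ∘ g) (suc m)) ≡ g m + n * m
  gaps-telescope zero    g g<n g≢ = refl
  gaps-telescope (suc m) g g<n g≢ = +-cancelʳ-≡ (g 1) _ _ (begin
    sumUpTo G (suc m) + g 0 + n * (β + A) + g 1   ≡⟨ cong (λ s → s + g 0 + n * (β + A) + g 1) (sumUpTo-suc m G) ⟩
    G 0 + S + g 0 + n * (β + A) + g 1             ≡⟨ solve 7 (λ G₀ S g₀ β A g₁ n → G₀ :+ S :+ g₀ :+ n :* (β :+ A) :+ g₁
                                                       := (G₀ :+ g₀ :+ n :* β) :+ (S :+ g₁ :+ n :* A)) refl (G 0) S (g 0) β A (g 1) n ⟩
    (G 0 + g 0 + n * β) + (S + g 1 + n * A)       ≡⟨ cong₂ _+_ (gap-step (g<n 0) (g<n 1) (g≢ z<s))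
                                                       (gaps-telescope m (g ∘ suc) (g<n ∘ suc) (λ i<m → g≢ (s<s i<m))) ⟩
    (g 1 + n) + (g (suc m) + n * m)               ≡⟨ solve 4 (λ g₁ n gₘ m → (g₁ :+ n) :+ (gₘ :+ n :* m)
                                                       := gₘ :+ n :* (con 1 :+ m) :+ g₁) refl (g 1) n (g (suc m)) m ⟩
    g (suc m) + n * suc m + g 1                   ∎)
    where
      open ≡-Reasoning
      open +-*-Solver
      G : ℕ → ℕ
      G i = gap (g i) (g (suc i))
      S β A : ℕ
      S = sumUpTo (G ∘ suc) m
      β = if g 0 <ᵇ g 1 then 1 else 0
      A = asc (applyUpTo (suc ∘ g ∘ suc) (suc m))

  gap-cong : ∀ {a a′ b b′} → a ≋ a′ → b ≋ b′ → gap a b ≡ gap a′ b′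
  gap-cong a≋a′ b≋b′ = %-≡ (+-cong-≋ b≋b′ (*-cong-≋ (≋-refl {N}) a≋a′))

  gap-translate : ∀ a b p → gap (a + p) (b + p) ≡ gap a b
  gap-translate a b p = gap-unique (gap<n a b)
    (≋-trans (≡⇒≋ (sym (+-assoc (gap a b) a p))) (+-cong-≋ (gap-+ a b) ≋-refl))

  bump-suc-% : ∀ x → bump n (suc (x % n)) ≡ suc (suc x % n)
  bump-suc-% x with x % n ≟ N
  ... | yes x%n≡N = begin
    bump n (suc (x % n)) ≡⟨ cong (bump n ∘ suc) x%n≡N ⟩
    bump n n             ≡⟨ if-true (≡ᵇ-refl n) ⟩
    1                    ≡⟨ cong suc (suc-%-wrap x x%n≡N) ⟨
    suc (suc x % n)      ∎
    where open ≡-Reasoning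
  ... | no x%n≢N = trans (if-false (≢⇒≡ᵇ≡false (x%n≢N ∘ suc-injective))) (cong suc (sym (suc-% x x%n≢N)))

gcd>1⇒small-multiple : ∀ {n k d q} .{{_ : NonZero n}} → d * q ≡ n → 1 < gcd k q →
  ∃[ m ] 0 < m * d × m * d < n × n ∣ m * (d * (n ∸ k))
gcd>1⇒small-multiple {n} {k} {d} {q} dq≡n 1<g
  with divides q′ q≡q′g ← gcd[m,n]∣n k q | divides k′ k≡k′g ← gcd[m,n]∣m k q =
  q′ , n≢0⇒n>0 X≢0 , X<n , divides (X ∸ k′) q′dc≡[X-k′]n
  where
    open ≡-Reasoning
    open +-*-Solver
    g X : ℕ
    g = gcd k q
    X = q′ * d
    Xg≡n : X * g ≡ n
    Xg≡n = begin
      q′ * d * g   ≡⟨ solve 3 (λ q′ d g → q′ :* d :* g := d :* (q′ :* g)) refl q′ d g ⟩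
      d * (q′ * g) ≡⟨ cong (d *_) q≡q′g ⟨
      d * q        ≡⟨ dq≡n ⟩
      n            ∎
    X≢0 : X ≢ 0
    X≢0 X≡0 = ≢-nonZero⁻¹ n (trans (sym Xg≡n) (cong (_* g) X≡0))
    X<n : X < n
    X<n = subst (X <_) Xg≡n (m<m*n X g {{≢-nonZero X≢0}} 1<g)
    q′dc≡[X-k′]n : q′ * (d * (n ∸ k)) ≡ (X ∸ k′) * n
    q′dc≡[X-k′]n = begin
      q′ * (d * (n ∸ k))               ≡⟨ cong (λ c → q′ * (d * c)) (cong₂ _∸_ (sym Xg≡n) k≡k′g) ⟩
      q′ * (d * (X * g ∸ k′ * g))      ≡⟨ cong (λ c → q′ * (d * c)) (*-distribʳ-∸ g X k′) ⟨
      q′ * (d * ((X ∸ k′) * g))        ≡⟨ solve 4 (λ q′ d u g → q′ :* (d :* (u :* g)) := u :* (q′ :* d :* g)) refl q′ d (X ∸ k′) g ⟩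
      (X ∸ k′) * (X * g)               ≡⟨ cong ((X ∸ k′) *_) Xg≡n ⟩
      (X ∸ k′) * n                     ∎

Eminus-parity : ℕ → ℕ → ℕ → List ℕ → Set
Eminus-parity n k b A = IsPerm n A × asc A ≡ k × inv A % 2 ≡ b × FirstLessLast A

NumOrbits-none : ∀ {n S p} → (∀ A → S A → HasPeriod n A p → ⊥) → NumOrbits n S p 0
NumOrbits-none none = [] , refl , [] , [] , λ A SA period → ⊥-elim (none A SA period)

NumOrbits-single : ∀ {n S p} R → S R → HasPeriod n R p →
  (∀ A → S A → HasPeriod n A p → InOrbit n R A) → NumOrbits n S p 1
NumOrbits-single R SR period all = [ R ] , refl , (SR , period) ∷ [] , [] ∷ [] ,
  λ A SA periodA → here (all A SA periodA)

-- σ-orbits of cyclic words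

module _ (M : ℕ) where

  open Congruence (suc M)

  module CyclicWord (V : ℕ → ℕ) (V<n : ∀ j → V j < n)
    (V-cong : ∀ {a b} → a ≋ b → V a ≡ V b)
    (V-injective : ∀ {a b} → V a ≡ V b → a ≋ b)
    (V₀<V_N : V 0 < V (suc M)) where

    N : ℕ
    N = suc M

    -- As N ≡ −1, V (j + r * N) is V (j − r): word r t is A₀ rotated r places to the right
    -- with t added to every entry modulo n.
    entry : ℕ → ℕ → ℕ → ℕ
    entry r t j = suc ((V (j + r * N) + t) % n)

    word : ℕ → ℕ → List ℕ
    word r t = applyUpTo (entry r t) n

    A₀ : List ℕ
    A₀ = word 0 0

    firstVal : ℕ → ℕ → ℕ
    firstVal r t = (V (r * N) + t) % n

    lastVal : ℕ → ℕ → ℕ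
    lastVal r t = (V (N + r * N) + t) % n

    FirstBelowLast : ℕ → ℕ → Set
    FirstBelowLast r t = firstVal r t < lastVal r t

    δ : ℕ → ℕ
    δ l = gap (V (suc l * N)) (V (l * N))

    Δ : ℕ → ℕ
    Δ = sumUpTo δ

    entry-0-0 : ∀ j → entry 0 0 j ≡ suc (V j)
    entry-0-0 j = cong suc (trans (cong (_% n) (trans (+-identityʳ _) (cong V (+-identityʳ j))))
                                  (m<n⇒m%n≡m (V<n j)))

    entry-injective : ∀ r t {i j} → i < n → j < n → entry r t i ≡ entry r t j → i ≡ j
    entry-injective r t {i} {j} i<n j<n eq = ≋⇒≡ i<n j<n (+-cancelʳ-≋ (r * N) (V-injective
      (≋⇒≡ (V<n (i + r * N)) (V<n (j + r * N)) (+-cancelʳ-≋ t (mk≋ (suc-injective eq))))))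

    word-isPerm : ∀ r t → IsPerm n (word r t)
    word-isPerm r t = unique⇒IsPerm n
      (Unique.applyUpTo⁺₁ (entry r t) n (λ i<j j<n → <⇒≢ i<j ∘ entry-injective r t (<-trans i<j j<n) j<n))
      (applyUpTo⁺₁ (entry r t) n (λ {j} _ → s≤s z≤n , m%n<n (V (j + r * N) + t) n))
      (≤-reflexive (sym (length-applyUpTo (entry r t) n)))

    word-∷ʳ : ∀ r t → word r t ≡ entry r t 0 ∷ (applyUpTo (entry r t ∘ suc) M ∷ʳ entry r t N)
    word-∷ʳ r t = cong (entry r t 0 ∷_) (sym (applyUpTo-∷ʳ (entry r t ∘ suc) M))

    firstVal<N : ∀ {r t} → FirstBelowLast r t → firstVal r t < N
    firstVal<N {r} {t} ordered = <-≤-trans ordered (≤-pred (m%n<n (V (N + r * N) + t) n))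

    ordered-0-0 : FirstBelowLast 0 0
    ordered-0-0 = subst₂ _<_ (suc-injective (sym (entry-0-0 0))) (suc-injective (sym (entry-0-0 N))) V₀<V_N

    A₀-FirstLessLast : FirstLessLast A₀
    A₀-FirstLessLast = entry 0 0 0 , applyUpTo (entry 0 0 ∘ suc) M , entry 0 0 N , word-∷ʳ 0 0 , s≤s ordered-0-0

    module Rotation {r t} (ordered : FirstBelowLast r t) (last≡N : lastVal r t ≡ N) where

      head-entry : entry (suc r) (suc t) 0 ≡ 1
      head-entry = cong suc (trans (cong (_% n) (+-suc (V (N + r * N)) t)) (suc-%-wrap (V (N + r * N) + t) last≡N))

      tail-entry : ∀ {j} → j < N → entry (suc r) (suc t) (suc j) ≡ suc (entry r t j)
      tail-entry {j} j<N = cong suc (begin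
        (V (suc j + suc r * N) + suc t) % n ≡⟨ cong (λ v → (v + suc t) % n) (V-cong unrotate) ⟩
        (V (j + r * N) + suc t) % n         ≡⟨ cong (_% n) (+-suc (V (j + r * N)) t) ⟩
        suc (V (j + r * N) + t) % n         ≡⟨ suc-% (V (j + r * N) + t) not-last ⟩
        suc ((V (j + r * N) + t) % n)       ∎)
        where
          open ≡-Reasoning
          open +-*-Solver
          unrotate : suc j + suc r * N ≋ j + r * N
          unrotate = ≋-trans (≡⇒≋ (solve 3 (λ j r M → (con 1 :+ j) :+ (con 1 :+ r) :* (con 1 :+ M)
                                              := j :+ r :* (con 1 :+ M) :+ (con 2 :+ M)) refl j r M))
                             (+-≋0 (j + r * N) n≋0)
          not-last : (V (j + r * N) + t) % n ≢ N
          not-last eq = <⇒≢ j<N (entry-injective r t (m<n⇒m<1+n j<N) ≤-refl (cong suc (trans eq (sym last≡N))))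

      σ-word : σ n (word r t) ≡ word (suc r) (suc t)
      σ-word = begin
        σ n (word r t)                                           ≡⟨ cong (σ n) (word-∷ʳ r t) ⟩
        σ n (entry r t 0 ∷ (applyUpTo (entry r t ∘ suc) M ∷ʳ entry r t N))
          ≡⟨ cong (λ y → σ n (entry r t 0 ∷ (applyUpTo (entry r t ∘ suc) M ∷ʳ y))) (cong suc last≡N) ⟩
        σ n (entry r t 0 ∷ (applyUpTo (entry r t ∘ suc) M ∷ʳ n)) ≡⟨ σ-rotate _ _ (<⇒≢ (s≤s (firstVal<N {r} {t} ordered))) ⟩
        1 ∷ map suc (applyUpTo (entry r t) N)                    ≡⟨ cong (1 ∷_) (map-applyUpTo (entry r t) suc N) ⟩
        1 ∷ applyUpTo (suc ∘ entry r t) N                        ≡⟨ cong₂ _∷_ head-entry (applyUpTo-cong N tail-entry) ⟨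
        word (suc r) (suc t)                                     ∎
        where open ≡-Reasoning

      ordered′ : FirstBelowLast (suc r) (suc t)
      ordered′ = subst₂ _<_ (sym (suc-injective head-entry)) (sym (suc-injective (tail-entry ≤-refl))) z<s

      firstVal′ : firstVal (suc r) (suc t) ≡ 0
      firstVal′ = suc-injective head-entry

      δ-value : δ r ≡ suc (firstVal r t)
      δ-value = gap-unique (s≤s (firstVal<N {r} {t} ordered)) (begin
        suc ((b + t) % n) + a ≈⟨ +-cong-≋ (+-cong-≋ (≋-refl {1}) (%-≋ (b + t))) ≋-refl ⟩
        suc (b + t) + a       ≡⟨ solve 3 (λ a b t → con 1 :+ (b :+ t) :+ a := b :+ (con 1 :+ (a :+ t))) refl a b t ⟩
        b + suc (a + t)       ≈⟨ +-cong-≋ (≋-refl {b}) (+-cong-≋ (≋-refl {1}) (mk≋ (trans last≡N (sym (m<n⇒m%n≡m ≤-refl))))) ⟩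
        b + n                 ≈⟨ +-≋0 b n≋0 ⟩
        b                     ∎)
        where
          open ≋-Reasoning
          open +-*-Solver
          a b : ℕ
          a = V (suc r * N)
          b = V (r * N)

    module Shift {r t} (ordered : FirstBelowLast r t) (last≢N : lastVal r t ≢ N) where

      σ-word : σ n (word r t) ≡ word r (suc t)
      σ-word = begin
        σ n (word r t)                    ≡⟨ σ-shift _ _ (<⇒≢ (s≤s (firstVal<N {r} {t} ordered))) last-not-n ⟩
        map (bump n) (word r t)           ≡⟨ map-applyUpTo (entry r t) (bump n) n ⟩
        applyUpTo (bump n ∘ entry r t) n  ≡⟨ applyUpTo-cong n (λ {j} _ → shifted j) ⟩
        word r (suc t)                    ∎
        where
          open ≡-Reasoning
          last-not-n : lastIs n (word r t) ≡ false
          last-not-n = trans (cong (lastIs n) (word-∷ʳ r t))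
            (trans (lastIs-∷ʳ n (applyUpTo (entry r t) N) (entry r t N)) (≢⇒≡ᵇ≡false (last≢N ∘ suc-injective)))
          shifted : ∀ j → bump n (entry r t j) ≡ entry r (suc t) j
          shifted j = trans (bump-suc-% (V (j + r * N) + t)) (cong (λ v → suc (v % n)) (sym (+-suc (V (j + r * N)) t)))

      firstVal′ : firstVal r (suc t) ≡ suc (firstVal r t)
      firstVal′ = trans (cong (_% n) (+-suc (V (r * N)) t)) (suc-% (V (r * N) + t) (<⇒≢ (firstVal<N {r} {t} ordered)))

      lastVal′ : lastVal r (suc t) ≡ suc (lastVal r t)
      lastVal′ = trans (cong (_% n) (+-suc (V (N + r * N)) t)) (suc-% (V (N + r * N) + t) last≢N)

      ordered′ : FirstBelowLast r (suc t)
      ordered′ = subst₂ _<_ (sym firstVal′) (sym lastVal′) (s≤s ordered)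

    -- The first value grows by one per step and drops to 0 at a rotation; δ r is the number of
    -- steps from the r-th rotation to the next, so the potential recovers the elapsed time.
    record State (t : ℕ) : Set where
      constructor mkState
      field
        rotations : ℕ
        reached   : σ^ n t A₀ ≡ word rotations t
        ordered   : FirstBelowLast rotations t
        potential : t + V 0 ≡ firstVal rotations t + Δ rotations

    state : ∀ t → State t
    state zero = mkState 0 refl ordered-0-0 (sym (trans (+-identityʳ _) (suc-injective (entry-0-0 0))))
    state (suc t) with state t
    ... | mkState r reached ordered potential with lastVal r t ≟ N
    ...   | yes last≡N = mkState (suc r) (trans (cong (σ n) reached) σ-word) ordered′ (begin
      suc (t + V 0)                          ≡⟨ cong suc potential ⟩
      suc (firstVal r t + Δ r)               ≡⟨ cong suc (+-comm (firstVal r t) (Δ r)) ⟩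
      suc (Δ r + firstVal r t)               ≡⟨ +-suc (Δ r) (firstVal r t) ⟨
      Δ r + suc (firstVal r t)               ≡⟨ cong (Δ r +_) δ-value ⟨
      Δ r + δ r                              ≡⟨ cong (_+ (Δ r + δ r)) firstVal′ ⟨
      firstVal (suc r) (suc t) + Δ (suc r)   ∎)
      where
        open Rotation {r} {t} ordered last≡N
        open ≡-Reasoning
    ...   | no last≢N = mkState r (trans (cong (σ n) reached) σ-word) ordered′
      (trans (cong suc potential) (cong (_+ Δ r) (sym firstVal′)))
      where open Shift {r} {t} ordered last≢N

    Symmetry : ℕ → ℕ → Set
    Symmetry r p = ∀ j → V (j + r * N) + p ≋ V j

    return⇒symmetry : ∀ {p} → σ^ n p A₀ ≡ A₀ → ∃[ r ] Symmetry r p × p ≡ Δ r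
    return⇒symmetry {p} returns with mkState r reached _ potential ← state p = r , symmetry , p≡Δr
      where
        same-word : word r p ≡ A₀
        same-word = trans (sym reached) returns
        symmetry-below-n : ∀ {j} → j < n → V (j + r * N) + p ≋ V j
        symmetry-below-n {j} j<n = mk≋ (trans (suc-injective (applyUpTo-cong⁻¹ n {entry r p} {entry 0 0} same-word j<n))
                                            (trans (suc-injective (entry-0-0 j)) (sym (m<n⇒m%n≡m (V<n j)))))
        symmetry : Symmetry r p
        symmetry j = begin
          V (j + r * N) + p     ≡⟨ cong (_+ p) (V-cong (+-cong-≋ (%-≋ j) (≋-refl {r * N}))) ⟨
          V (j % n + r * N) + p ≈⟨ symmetry-below-n (m%n<n j n) ⟩
          V (j % n)             ≡⟨ V-cong (%-≋ j) ⟩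
          V j                   ∎
          where open ≋-Reasoning
        p≡Δr : p ≡ Δ r
        p≡Δr = +-cancelʳ-≡ (V 0) p (Δ r) (begin
          p + V 0              ≡⟨ potential ⟩
          firstVal r p + Δ r   ≡⟨ cong (_+ Δ r) (trans (%-≡ (symmetry 0)) (m<n⇒m%n≡m (V<n 0))) ⟩
          V 0 + Δ r            ≡⟨ +-comm (V 0) (Δ r) ⟩
          Δ r + V 0            ∎)
          where open ≡-Reasoning

    V-progression : ∀ {r p} → Symmetry r p → ∀ m → V (m * r) ≋ V 0 + m * p
    V-progression {r} {p} symmetry zero    = ≡⇒≋ (sym (+-identityʳ (V 0)))
    V-progression {r} {p} symmetry (suc m) = begin
      V (suc m * r)                  ≈⟨ symmetry (suc m * r) ⟨
      V (suc m * r + r * N) + p      ≡⟨ cong (_+ p) (V-cong unrotate) ⟩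
      V (m * r) + p                  ≈⟨ +-cong-≋ (V-progression symmetry m) ≋-refl ⟩
      V 0 + m * p + p                ≡⟨ solve 3 (λ v m p → v :+ m :* p :+ p := v :+ (con 1 :+ m) :* p) refl (V 0) m p ⟩
      V 0 + suc m * p                ∎
      where
        open ≋-Reasoning
        open +-*-Solver
        unrotate : suc m * r + r * N ≋ m * r
        unrotate = ≋-trans (≡⇒≋ (solve 3 (λ m r M → (con 1 :+ m) :* r :+ r :* (con 1 :+ M)
                                            := m :* r :+ r :* (con 2 :+ M)) refl m r M))
                           (+-≋0 (m * r) (*n≋0 r))

    δ-periodic : ∀ {r p} → Symmetry r p → ∀ l → δ (r + l) ≡ δ l
    δ-periodic {r} {p} symmetry l = begin
      δ (r + l)                                                ≡⟨ cong₂ (λ a b → gap (V a) (V b))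
                                                                    (solve 3 (λ r l N → (con 1 :+ (r :+ l)) :* N := (con 1 :+ l) :* N :+ r :* N) refl r l N)
                                                                    (solve 3 (λ r l N → (r :+ l) :* N := l :* N :+ r :* N) refl r l N) ⟩
      gap (V (suc l * N + r * N)) (V (l * N + r * N))         ≡⟨ gap-translate (V (suc l * N + r * N)) (V (l * N + r * N)) p ⟨
      gap (V (suc l * N + r * N) + p) (V (l * N + r * N) + p) ≡⟨ gap-cong (symmetry (suc l * N)) (symmetry (l * N)) ⟩
      δ l                                                      ∎
      where
        open ≡-Reasoning
        open +-*-Solver

    δ-periodic-n : ∀ l → δ (n + l) ≡ δ l
    δ-periodic-n l = cong₂ gap (V-cong (drop-n (suc l * N) (solve 3 (λ N n l → (con 1 :+ (n :+ l)) :* N := (con 1 :+ l) :* N :+ N :* n) refl N n l)))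
                               (V-cong (drop-n (l * N) (solve 3 (λ N n l → (n :+ l) :* N := l :* N :+ N :* n) refl N n l)))
      where
        open +-*-Solver
        drop-n : ∀ a {b} → b ≡ a + N * n → b ≋ a
        drop-n a refl = +-≋0 a (*n≋0 N)

    gapAfter : ℕ → ℕ
    gapAfter i = gap (V i) (V (suc i))

    δ-reversed : ∀ {l} → l < n → δ l ≡ gapAfter (N ∸ l)
    δ-reversed {l} l<n = cong₂ gap (V-cong (mk≋ (trans (cong (_% n) e₁) ([m+kn]%n≡m%n u l n))))
                                   (V-cong (≋-trans (≋-sym (+-≋0 (l * N) n≋0)) (mk≋ (trans (cong (_% n) e₂) ([m+kn]%n≡m%n (suc u) l n)))))
      where
        open +-*-Solver
        u : ℕ
        u = N ∸ l
        u+l≡N : u + l ≡ N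
        u+l≡N = m∸n+n≡m (≤-pred l<n)
        e₁ : suc l * N ≡ u + l * n
        e₁ = subst (λ K → suc l * K ≡ u + l * suc K) u+l≡N
               (solve 2 (λ u l → (con 1 :+ l) :* (u :+ l) := u :+ l :* (con 1 :+ (u :+ l))) refl u l)
        e₂ : l * N + n ≡ suc u + l * n
        e₂ = subst (λ K → l * K + suc K ≡ suc u + l * suc K) u+l≡N
               (solve 2 (λ u l → l :* (u :+ l) :+ (con 1 :+ (u :+ l)) := (con 1 :+ u) :+ l :* (con 1 :+ (u :+ l))) refl u l)

    V-≋-injective : ∀ {a b} → V a ≋ V b → a ≋ b
    V-≋-injective {a} {b} Va≋Vb = V-injective (≋⇒≡ (V<n a) (V<n b) Va≋Vb)

    V-steps-distinct : ∀ {i} → i < N → V i ≢ V (suc i)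
    V-steps-distinct {i} i<N eq = <⇒≢ (n<1+n i) (≋⇒≡ (m<n⇒m<1+n i<N) (s≤s i<N) (V-injective eq))

    -- The gaps telescope around the cycle; each cyclic descent of A₀, the wrap-around aₙ > a₁
    -- included, contributes n.
    sum-gapAfter : sumUpTo gapAfter n + n * asc A₀ ≡ n * n
    sum-gapAfter = +-cancelʳ-≡ (V 0 + V N) _ _ (begin
      X + gapAfter N + n * a + (V 0 + V N)           ≡⟨ solve 6 (λ X g a v₀ v n → X :+ g :+ n :* a :+ (v₀ :+ v) := (X :+ v₀ :+ n :* a) :+ (g :+ v))
                                                           refl X (gapAfter N) a (V 0) (V N) n ⟩
      (X + V 0 + n * a) + (gapAfter N + V N)         ≡⟨ cong₂ _+_ telescope closing ⟩
      (V N + n * N) + (V 0 + n)                      ≡⟨ solve 3 (λ v v₀ N → (v :+ (con 1 :+ N) :* N) :+ (v₀ :+ (con 1 :+ N))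
                                                           := (con 1 :+ N) :* (con 1 :+ N) :+ (v₀ :+ v)) refl (V N) (V 0) N ⟩
      n * n + (V 0 + V N)                            ∎)
      where
        open ≡-Reasoning
        open +-*-Solver
        X a : ℕ
        X = sumUpTo gapAfter N
        a = asc A₀
        telescope : X + V 0 + n * a ≡ V N + n * N
        telescope = trans (cong (λ b → X + V 0 + n * b) (cong asc (applyUpTo-cong n (λ {j} _ → entry-0-0 j))))
                          (gaps-telescope N V V<n V-steps-distinct)
        closing : gapAfter N + V N ≡ V 0 + n
        closing = trans (cong (λ v → gap (V N) v + V N) (V-cong n≋0)) (gap-wraps V₀<V_N (V<n N))

    cyclic-sum : Δ n + n * asc A₀ ≡ n * n
    cyclic-sum = trans (cong (_+ n * asc A₀) (trans (sumUpTo-cong n δ-reversed) (sumUpTo-reverse N gapAfter))) sum-gapAfter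

    return⇒period-multiple : ∀ {k p} → asc A₀ ≡ k → k ≤ n → σ^ n p A₀ ≡ A₀ →
      ∃[ r ] Symmetry r p × p ≡ r * (n ∸ k)
    return⇒period-multiple {k} {p} asc≡k k≤n returns with r , symmetry , p≡Δr ← return⇒symmetry returns =
      r , symmetry , trans p≡Δr (*-cancelˡ-≡ (Δ r) (r * c) n n*Δr)
      where
        open ≡-Reasoning
        open +-*-Solver
        c : ℕ
        c = n ∸ k
        Δn : Δ n ≡ n * c
        Δn = +-cancelʳ-≡ (n * k) _ _ (begin
          Δ n + n * k      ≡⟨ cong (λ a → Δ n + n * a) asc≡k ⟨
          Δ n + n * asc A₀ ≡⟨ cyclic-sum ⟩
          n * n            ≡⟨ cong (n *_) (m∸n+n≡m k≤n) ⟨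
          n * (c + k)      ≡⟨ *-distribˡ-+ n c k ⟩
          n * c + n * k    ∎)
        n*Δr : n * Δ r ≡ n * (r * c)
        n*Δr = begin
          n * Δ r     ≡⟨ sumUpTo-periodic r δ (δ-periodic {r} symmetry) n ⟨
          Δ (n * r)   ≡⟨ cong Δ (*-comm n r) ⟩
          Δ (r * n)   ≡⟨ sumUpTo-periodic n δ δ-periodic-n r ⟩
          r * Δ n     ≡⟨ cong (r *_) Δn ⟩
          r * (n * c) ≡⟨ solve 3 (λ r n c → r :* (n :* c) := n :* (r :* c)) refl r n c ⟩
          n * (r * c) ∎

    return⇒m*d≋0 : ∀ {k d m} → asc A₀ ≡ k → k < n → σ^ n (d * (n ∸ k)) A₀ ≡ A₀ →
      n ∣ m * (d * (n ∸ k)) → m * d ≋ 0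
    return⇒m*d≋0 {k} {d} {m} asc≡k k<n returns n∣mdc
      with r , symmetry , dc≡rc ← return⇒period-multiple asc≡k (<⇒≤ k<n) returns = V-≋-injective (begin
        V (m * d)                ≈⟨ V-progression (subst (λ r → Symmetry r (d * (n ∸ k))) (sym d≡r) symmetry) m ⟩
        V 0 + m * (d * (n ∸ k))  ≈⟨ +-≋0 (V 0) (∣⇒≋0 n∣mdc) ⟩
        V 0                      ∎)
      where
        open ≋-Reasoning
        d≡r : d ≡ r
        d≡r = *-cancelʳ-≡ d r (n ∸ k) {{>-nonZero (m<n⇒0<n∸m k<n)}} dc≡rc

    inv-parity-invariant : n % 2 ≡ 1 → ∀ t → inv (σ^ n t A₀) % 2 ≡ inv A₀ % 2
    inv-parity-invariant odd zero    = refl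
    inv-parity-invariant odd (suc t) with mkState r reached ordered _ ← state t = begin
      inv (σ n (σ^ n t A₀)) % 2 ≡⟨ cong (λ w → inv (σ n w) % 2) reached ⟩
      inv (σ n (word r t)) % 2  ≡⟨ σ-preserves-inv-parity odd (word-isPerm r t) head≢n ⟩
      inv (word r t) % 2        ≡⟨ cong (λ w → inv w % 2) reached ⟨
      inv (σ^ n t A₀) % 2       ≡⟨ inv-parity-invariant odd t ⟩
      inv A₀ % 2                ∎
      where
        open ≡-Reasoning
        head≢n : ∀ {xs} → word r t ≢ n ∷ xs
        head≢n eq = <⇒≢ (firstVal<N {r} {t} ordered) (suc-injective (∷-injectiveˡ eq))

  module Encoding {A : List ℕ} (A↭ : IsPerm n A) (fll : FirstLessLast A) where

    |A|≡n : length A ≡ n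
    |A|≡n = IsPerm⇒length A↭

    index< : ∀ j → j % n < length A
    index< j = subst (j % n <_) (sym |A|≡n) (m%n<n j n)

    V : ℕ → ℕ
    V j = pred (at A (j % n))

    suc-V : ∀ j → suc (V j) ≡ at A (j % n)
    suc-V j = suc-pred (at A (j % n)) {{>-nonZero (proj₁ (All-at (IsPerm⇒InRange A↭) (index< j)))}}

    V<n : ∀ j → V j < n
    V<n j = subst (_≤ n) (sym (suc-V j)) (proj₂ (All-at (IsPerm⇒InRange A↭) (index< j)))

    V-cong : ∀ {a b} → a ≋ b → V a ≡ V b
    V-cong a≋b = cong (pred ∘ at A) (%-≡ a≋b)

    V-injective : ∀ {a b} → V a ≡ V b → a ≋ b
    V-injective {a} {b} eq = mk≋ (Unique-at-injective (IsPerm⇒Unique A↭) (index< a) (index< b)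
      (trans (sym (suc-V a)) (trans (cong suc eq) (suc-V b))))

    FirstLessLast⇒V₀<V_N : FirstLessLast A → V 0 < V (suc M)
    FirstLessLast⇒V₀<V_N (x , mid , y , A≡x∷mid∷ʳy , x<y) = ≤-pred (subst₂ _<_ (sym (suc-V 0)) (sym (suc-V (suc M))) at₀<at_N)
      where
        |mid|≡M : length mid ≡ M
        |mid|≡M = suc-injective (suc-injective (begin
          suc (suc (length mid))       ≡⟨ cong suc (+-comm 1 (length mid)) ⟩
          suc (length mid + 1)         ≡⟨ cong suc (length-++ mid) ⟨
          length (x ∷ (mid ∷ʳ y))      ≡⟨ cong length A≡x∷mid∷ʳy ⟨
          length A                     ≡⟨ |A|≡n ⟩
          suc (suc M)                  ∎))
          where open ≡-Reasoning
        at₀<at_N : at A 0 < at A (suc M % n)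
        at₀<at_N = subst₂ _<_ (cong (λ L → at L 0) (sym A≡x∷mid∷ʳy))
          (sym (begin
            at A (suc M % n)           ≡⟨ cong (at A) (m<n⇒m%n≡m ≤-refl) ⟩
            at A (suc M)               ≡⟨ cong (λ L → at L (suc M)) A≡x∷mid∷ʳy ⟩
            at (mid ∷ʳ y) M            ≡⟨ cong (at (mid ∷ʳ y)) |mid|≡M ⟨
            at (mid ∷ʳ y) (length mid) ≡⟨ at-∷ʳ mid y ⟩
            y                          ∎)) x<y
          where open ≡-Reasoning

    open CyclicWord V V<n V-cong V-injective (FirstLessLast⇒V₀<V_N fll) public

    A₀≡A : A₀ ≡ A
    A₀≡A = begin
      applyUpTo (entry 0 0) n      ≡⟨ applyUpTo-cong n (λ {j} j<n → trans (entry-0-0 j) (trans (suc-V j) (cong (at A) (m<n⇒m%n≡m j<n)))) ⟩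
      applyUpTo (at A) n           ≡⟨ cong (applyUpTo (at A)) |A|≡n ⟨
      applyUpTo (at A) (length A)  ≡⟨ applyUpTo-at A ⟩
      A                            ∎
      where open ≡-Reasoning

  module _ {k d q : ℕ} {A : List ℕ}
    (k<n : k < n) (dq≡n : d * q ≡ n) (1<g : 1 < gcd k q)
    (A↭ : IsPerm n A) (asc≡k : asc A ≡ k) (fll : FirstLessLast A) where

    open Encoding A↭ fll

    no-return-when-gcd>1 : σ^ n (d * (n ∸ k)) A ≢ A
    no-return-when-gcd>1 returns =
      let m , 0<md , md<n , n∣mdc = gcd>1⇒small-multiple {k = k} {d = d} dq≡n 1<g
      in <⇒≢ 0<md (sym (≋⇒≡ md<n z<s (return⇒m*d≋0 {d = d} {m = m} (trans (cong asc A₀≡A) asc≡k) k<n A₀-returns n∣mdc)))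
      where
        A₀-returns : σ^ n (d * (n ∸ k)) A₀ ≡ A₀
        A₀-returns = subst (λ B → σ^ n (d * (n ∸ k)) B ≡ B) (sym A₀≡A) returns

  no-orbits-when-gcd>1 : ∀ {k d q b} → k < n → d * q ≡ n → 1 < gcd k q →
    NumOrbits n (Eminus-parity n k b) (d * (n ∸ k)) 0
  no-orbits-when-gcd>1 {d = d} k<n dq≡n 1<g = NumOrbits-none λ where
    A (A↭ , asc≡k , _ , fll) (_ , returns , _) → no-return-when-gcd>1 {d = d} k<n dq≡n 1<g A↭ asc≡k fll returns

  module CoprimeCase (k : ℕ)
    (0<k : 0 < k) (k<n : k < n) (coprime : Coprime k n) where

    c : ℕ
    c = n ∸ k

    c+k≡n : c + k ≡ n
    c+k≡n = m∸n+n≡m (<⇒≤ k<n)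

    0<c : 0 < c
    0<c = m<n⇒0<n∸m k<n

    c<n : c < n
    c<n = ∸-monoʳ-< 0<k (<⇒≤ k<n)

    coprime-c : Coprime c n
    coprime-c {i} (i∣c , i∣n) = coprime (∣m+n∣m⇒∣n (subst (i ∣_) (sym c+k≡n) i∣n) i∣c , i∣n)

    VP : ℕ → ℕ
    VP j = (j * c) % n

    VP<n : ∀ j → VP j < n
    VP<n j = m%n<n (j * c) n

    VP-cong : ∀ {a b} → a ≋ b → VP a ≡ VP b
    VP-cong a≋b = %-≡ (*-cong-≋ a≋b (≋-refl {c}))

    VP-injective : ∀ {a b} → VP a ≡ VP b → a ≋ b
    VP-injective VPa≡VPb = *-cancelʳ-≋ coprime-c (mk≋ VPa≡VPb)

    VP₀<VP_N : VP 0 < VP (suc M)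
    VP₀<VP_N = n≢0⇒n>0 λ VP_N≡0 → <⇒≢ 0<c (sym (≋⇒≡ c<n z<s (c≋0 VP_N≡0)))
      where
        c≋0 : VP (suc M) ≡ 0 → c ≋ 0
        c≋0 VP_N≡0 = begin
          c                ≈⟨ +-≋0 c (mk≋ VP_N≡0) ⟨
          c + suc M * c    ≈⟨ n*≋0 c ⟩
          0                ∎
          where open ≋-Reasoning

    open CyclicWord VP VP<n VP-cong VP-injective VP₀<VP_N

    P≡A₀ : P n c ≡ A₀
    P≡A₀ = trans (map-upTo (λ j → (j * c) % n + 1) n)
                 (applyUpTo-cong n (λ {j} _ → trans (+-comm ((j * c) % n) 1) (sym (entry-0-0 j))))

    δ-const : ∀ l → δ l ≡ c
    δ-const l = gap-unique c<n (begin
      c + VP (suc l * N)      ≈⟨ +-cong-≋ (≋-refl {c}) (%-≋ (suc l * N * c)) ⟩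
      c + suc l * N * c       ≡⟨ solve 3 (λ c l N → c :+ (con 1 :+ l) :* N :* c := l :* N :* c :+ (con 1 :+ N) :* c) refl c l N ⟩
      l * N * c + n * c       ≈⟨ +-≋0 (l * N * c) (n*≋0 c) ⟩
      l * N * c               ≈⟨ %-≋ (l * N * c) ⟨
      VP (l * N)              ∎)
      where
        open ≋-Reasoning
        open +-*-Solver

    Δ-linear : ∀ r → Δ r ≡ r * c
    Δ-linear r = trans (sumUpTo-cong r (λ {l} _ → δ-const l)) (sumUpTo-const r c)

    asc-A₀ : asc A₀ ≡ k
    asc-A₀ = *-cancelˡ-≡ (asc A₀) k n (+-cancelˡ-≡ (n * c) _ _ (begin
      n * c + n * asc A₀  ≡⟨ cong (_+ n * asc A₀) (Δ-linear n) ⟨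
      Δ n + n * asc A₀    ≡⟨ cyclic-sum ⟩
      n * n               ≡⟨ cong (n *_) c+k≡n ⟨
      n * (c + k)         ≡⟨ *-distribˡ-+ n c k ⟩
      n * c + n * k       ∎))
      where open ≡-Reasoning

    rotations-bound : ∀ {t} (s : State t) → State.rotations s * c ≤ t
    rotations-bound {t} (mkState r _ _ potential) = begin
      r * c                ≤⟨ m≤n+m (r * c) (firstVal r t) ⟩
      firstVal r t + r * c ≡⟨ cong (firstVal r t +_) (Δ-linear r) ⟨
      firstVal r t + Δ r   ≡⟨ potential ⟨
      t + 0                ≡⟨ +-identityʳ t ⟩
      t                    ∎
      where open ≤-Reasoning

    orbit-before-c : ∀ {t} → t < c → σ^ n t A₀ ≡ word 0 t
    orbit-before-c {t} t<c = unrotated (state t)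
      where
        unrotated : State t → σ^ n t A₀ ≡ word 0 t
        unrotated (mkState zero reached _ _) = reached
        unrotated s@(mkState (suc r) _ _ _) =
          contradiction (≤-trans (m≤m+n c (r * c)) (rotations-bound s)) (<⇒≱ t<c)
    lastVal-0-c : lastVal 0 c ≡ 0
    lastVal-0-c = %-≡ (begin
      VP (N + 0) + c    ≈⟨ +-cong-≋ (%-≋ ((N + 0) * c)) (≋-refl {c}) ⟩
      (N + 0) * c + c   ≡⟨ solve 2 (λ N c → (N :+ con 0) :* c :+ c := (con 1 :+ N) :* c) refl N c ⟩
      n * c             ≈⟨ n*≋0 c ⟩
      0                 ∎)
      where
        open ≋-Reasoning
        open +-*-Solver

    word-1-c : word 1 c ≡ A₀
    word-1-c = applyUpTo-cong n λ {j} _ → trans (cong suc (%-≡ (entry-1-c j))) (sym (entry-0-0 j))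
      where
        open +-*-Solver
        entry-1-c : ∀ j → VP (j + 1 * N) + c ≋ j * c
        entry-1-c j = begin
          VP (j + 1 * N) + c    ≈⟨ +-cong-≋ (%-≋ ((j + 1 * N) * c)) (≋-refl {c}) ⟩
          (j + 1 * N) * c + c   ≡⟨ solve 3 (λ j N c → (j :+ con 1 :* N) :* c :+ c := j :* c :+ (con 1 :+ N) :* c) refl j N c ⟩
          j * c + n * c         ≈⟨ +-≋0 (j * c) (n*≋0 c) ⟩
          j * c                 ∎
          where open ≋-Reasoning

    returns-at-c : σ^ n c A₀ ≡ A₀
    returns-at-c = one-rotation (state c)
      where
        one-rotation : State c → σ^ n c A₀ ≡ A₀
        one-rotation (mkState zero _ ordered _)        = contradiction (subst (firstVal 0 c <_) lastVal-0-c ordered) n≮0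
        one-rotation (mkState (suc zero) reached _ _)  = trans reached word-1-c
        one-rotation s@(mkState (suc (suc r)) _ _ _) =
          contradiction (rotations-bound s) (<⇒≱ (m<m+n c (<-≤-trans 0<c (m≤m+n c (r * c)))))

    not-multiple : ∀ {ℓ} r → 0 < ℓ → ℓ < c → ℓ ≢ r * c
    not-multiple zero    0<ℓ _   ℓ≡0      = <⇒≢ 0<ℓ (sym ℓ≡0)
    not-multiple (suc r) _   ℓ<c ℓ≡[1+r]c = <⇒≱ ℓ<c (subst (c ≤_) (sym ℓ≡[1+r]c) (m≤m+n c (r * c)))

    A₀-period : HasPeriod n A₀ c
    A₀-period = 0<c , returns-at-c , λ ℓ 0<ℓ ℓ<c returns →
      let r , _ , ℓ≡rc = return⇒period-multiple asc-A₀ (<⇒≤ k<n) returns in not-multiple r 0<ℓ ℓ<c ℓ≡rc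

    module _ {A : List ℕ} (A↭ : IsPerm n A) (asc≡k : asc A ≡ k) (fll : FirstLessLast A)
             (returns : σ^ n c A ≡ A) where

      private module E = Encoding A↭ fll

      A-progression : ∀ j → E.V j ≋ E.V 0 + j * c
      A-progression j = ≋-trans (≡⇒≋ (cong E.V (sym (*-identityʳ j)))) (E.V-progression (one-rotation returns-multiple) j)
        where
          returns-multiple : ∃[ r ] E.Symmetry r c × c ≡ r * c
          returns-multiple = E.return⇒period-multiple (trans (cong asc E.A₀≡A) asc≡k) (<⇒≤ k<n)
                               (subst (λ B → σ^ n c B ≡ B) (sym E.A₀≡A) returns)
          one-rotation : ∃[ r ] E.Symmetry r c × c ≡ r * c → E.Symmetry 1 c
          one-rotation (r , symmetry , c≡rc) =
            subst (λ r → E.Symmetry r c) (*-cancelʳ-≡ r 1 c {{>-nonZero 0<c}} (trans (sym c≡rc) (sym (+-identityʳ c)))) symmetry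

      A-V₀<c : E.V 0 < c
      A-V₀<c = ≰⇒> λ c≤a₀ → <⇒≱ (E.FirstLessLast⇒V₀<V_N fll) (≤-trans (≤-reflexive (V_N≡a₀∸c c≤a₀)) (m∸n≤m (E.V 0) c))
        where
          V_N≡a₀∸c : c ≤ E.V 0 → E.V N ≡ E.V 0 ∸ c
          V_N≡a₀∸c c≤a₀ = ≋⇒≡ (E.V<n N) (≤-<-trans (m∸n≤m (E.V 0) c) (E.V<n 0)) (begin
            E.V N                        ≈⟨ A-progression N ⟩
            E.V 0 + N * c                ≡⟨ cong (_+ N * c) (m∸n+n≡m c≤a₀) ⟨
            E.V 0 ∸ c + c + N * c        ≡⟨ +-assoc (E.V 0 ∸ c) c (N * c) ⟩
            E.V 0 ∸ c + n * c            ≈⟨ +-≋0 (E.V 0 ∸ c) (n*≋0 c) ⟩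
            E.V 0 ∸ c                    ∎)
            where open ≋-Reasoning

      word-0-V₀≡A : word 0 (E.V 0) ≡ A
      word-0-V₀≡A = trans (applyUpTo-cong n λ {j} _ → trans (cong suc (entries j)) (sym (E.entry-0-0 j))) E.A₀≡A
        where
          entries : ∀ j → (VP (j + 0) + E.V 0) % n ≡ E.V j
          entries j = ≋⇒≡ (m%n<n (VP (j + 0) + E.V 0) n) (E.V<n j) (begin
            (VP (j + 0) + E.V 0) % n   ≈⟨ %-≋ (VP (j + 0) + E.V 0) ⟩
            VP (j + 0) + E.V 0         ≈⟨ +-cong-≋ (%-≋ ((j + 0) * c)) (≋-refl {E.V 0}) ⟩
            (j + 0) * c + E.V 0        ≡⟨ trans (+-comm _ (E.V 0)) (cong (λ i → E.V 0 + i * c) (+-identityʳ j)) ⟩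
            E.V 0 + j * c              ≈⟨ A-progression j ⟨
            E.V j                      ∎)
            where open ≋-Reasoning

      σ^V₀-A₀≡A : σ^ n (E.V 0) A₀ ≡ A
      σ^V₀-A₀≡A = trans (orbit-before-c A-V₀<c) word-0-V₀≡A

      in-orbit : InOrbit n A₀ A
      in-orbit = E.V 0 + c , ≤-trans 0<c (m≤n+m c (E.V 0)) , (begin
        σ^ n (E.V 0 + c) A₀       ≡⟨ σ^-+ n (E.V 0) c A₀ ⟩
        σ^ n (E.V 0) (σ^ n c A₀)  ≡⟨ cong (σ^ n (E.V 0)) returns-at-c ⟩
        σ^ n (E.V 0) A₀           ≡⟨ σ^V₀-A₀≡A ⟩
        A                         ∎)
        where open ≡-Reasoning

      same-parity : n % 2 ≡ 1 → inv A % 2 ≡ inv A₀ % 2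
      same-parity odd = trans (cong (λ B → inv B % 2) (sym σ^V₀-A₀≡A)) (inv-parity-invariant odd (E.V 0))

    orbits-same-parity : n % 2 ≡ 1 → NumOrbits n (Eminus-parity n k (inv A₀ % 2)) c 1
    orbits-same-parity odd = NumOrbits-single {n} {Eminus-parity n k (inv A₀ % 2)} {c} A₀ A₀-in-E A₀-period
      λ A (A↭ , asc≡k , _ , fll) (_ , returns , _) → in-orbit A↭ asc≡k fll returns
      where
        A₀-in-E : Eminus-parity n k (inv A₀ % 2) A₀
        A₀-in-E = word-isPerm 0 0 , asc-A₀ , refl , A₀-FirstLessLast

    orbits-other-parity : n % 2 ≡ 1 → ∀ {b} → b ≢ inv A₀ % 2 → NumOrbits n (Eminus-parity n k b) c 0
    orbits-other-parity odd b≢π = NumOrbits-none λ A (A↭ , asc≡k , parity , fll) (_ , returns , _) →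
      b≢π (trans (sym parity) (same-parity A↭ asc≡k fll returns odd))

    orbit-counts : n % 2 ≡ 1 →
      NumOrbits n (Eminus-e n k) c (ε n c) × NumOrbits n (Eminus-o n k) c (1 ∸ ε n c)
    orbit-counts odd = subst (λ e → NumOrbits n (Eminus-e n k) c e × NumOrbits n (Eminus-o n k) c (1 ∸ e))
      (sym ε≡) (by-parity refl (m%n<n (inv A₀) 2))
      where
        ε≡ : ε n c ≡ (if inv A₀ % 2 ≡ᵇ 0 then 1 else 0)
        ε≡ = cong (λ L → if inv L % 2 ≡ᵇ 0 then 1 else 0) P≡A₀
        by-parity : ∀ {π} → π ≡ inv A₀ % 2 → π < 2 →
          NumOrbits n (Eminus-e n k) c (if π ≡ᵇ 0 then 1 else 0) × NumOrbits n (Eminus-o n k) c (1 ∸ (if π ≡ᵇ 0 then 1 else 0))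
        by-parity {0} 0≡π _ = subst (λ b → NumOrbits n (Eminus-parity n k b) c 1) (sym 0≡π) (orbits-same-parity odd)
                            , orbits-other-parity odd (λ 1≡π → 1+n≢0 (trans 1≡π (sym 0≡π)))
        by-parity {1} 1≡π _ = orbits-other-parity odd (λ 0≡π → 0≢1+n (trans 0≡π (sym 1≡π)))
                            , subst (λ b → NumOrbits n (Eminus-parity n k b) c 1) (sym 1≡π) (orbits-same-parity odd)
        by-parity {2+ _} _ (s≤s (s≤s ()))

theorem5p1 : ∀ (n k : ℕ) → n % 2 ≡ 1 → 1 ≤ k → k ≤ n ∸ 1 →
    ((d q : ℕ) → d * q ≡ n → 1 < gcd k q →
        NumOrbits n (Eminus-e n k) (d * (n ∸ k)) 0
      × NumOrbits n (Eminus-o n k) (d * (n ∸ k)) 0)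
    × (gcd k n ≡ 1 →
        NumOrbits n (Eminus-e n k) (n ∸ k) (ε n (n ∸ k))
      × NumOrbits n (Eminus-o n k) (n ∸ k) (1 ∸ ε n (n ∸ k)))
theorem5p1 zero          k ()  _   _
theorem5p1 (suc zero)    k _   0<k k≤0 = contradiction k≤0 (<⇒≱ 0<k)
theorem5p1 (suc (suc M)) k odd 0<k k≤N =
    (λ d q dq≡n 1<g → no-orbits-when-gcd>1 M {d = d} {b = 0} (s≤s k≤N) dq≡n 1<g
                    , no-orbits-when-gcd>1 M {d = d} {b = 1} (s≤s k≤N) dq≡n 1<g)
  , (λ gcd≡1 → CoprimeCase.orbit-counts M k 0<k (s≤s k≤N) (gcd≡1⇒coprime gcd≡1) odd)
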